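{- For every $n\ge 1$, $$T_n(x,s,q)=xU_{n-1}(x,q^2s,q)+qsU_{n-2}(x,q^2s,q).$$
   Context: Let $q$ be a real number with $q\neq -1$. $T_0(x,s,q)=1$, $T_1(x,s,q)=x$, $T_n(x,s,q)=(1+q^{n-1})xT_{n-1}(x,s,q)+q^{n-1}sT_{n-2}(x,s,q)$ for $n\ge2$; $U_{ -1}(x,s,q)=0$, $U_0(x,s,q)=1$, $U_n(x,s,q)=(1+q^{n})xU_{n-1}(x,s,q)+q^{n-1}sU_{n-2}(x,s,q)$ for $n\ge 1$. -}

module Defs where

open import Level using (Level)
open import Data.Nat using (ℕ; zero; suc)
open import Algebra.Bundles using (CommutativeRing; Semiring)

-- The paper works over the reals; we work over an arbitrary commutative ring R
--.  Powers q ^ n are the ring's own `_^_` (q ^ 0 = 1).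
module Poly {c ℓ : Level} (R : CommutativeRing c ℓ) where
  open CommutativeRing R
  open import Algebra.Definitions.RawSemiring (Semiring.rawSemiring semiring) public using (_^_)

  T : ℕ → Carrier → Carrier → Carrier → Carrier
  T zero          x s q = 1#
  T (suc zero)    x s q = x
  T (suc (suc n)) x s q =
    (1# + q ^ suc n) * x * T (suc n) x s q + (q ^ suc n) * s * T n x s q

  -- U₋ k x s q  =  U_{k-1}(x,s,q)   (index shifted by one so that U_{-1} is
  -- representable):  U₋ 0 = U_{-1} = 0,  U₋ 1 = U_0 = 1, and for k ≥ 0,
  -- U₋ (k+2) = U_{k+1} = (1 + q^{k+1}) x U_k + q^k s U_{k-1}.
  U₋ : ℕ → Carrier → Carrier → Carrier → Carrier
  U₋ zero          x s q = 0#
  U₋ (suc zero)    x s q = 1#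
  U₋ (suc (suc k)) x s q =
    (1# + q ^ suc k) * x * U₋ (suc k) x s q + (q ^ k) * s * U₋ k x s q

-- Put V k = U₋ k x (q²s) q and W m = x V (m+1) + q s V m.  Then W 0 = T 1 and
-- W 1 = T 2, and W obeys the recurrence of T: expanding V (k+3) by its own
-- recurrence, the two sides of the recurrence for W differ by q s times the
-- recurrence defect of V at k+2, which vanishes.
-- The identity is polynomial.
module Submission where

open import Defs
open import Level using (Level)
open import Data.Nat using (ℕ; suc; zero)
open import Relation.Nullary using (¬_)
open import Algebra.Bundles using (CommutativeRing)
import Algebra.Solver.Ring.NaturalCoefficients.Default as RingSolver
import Relation.Binary.Reasoning.Setoid as SetoidReasoning

module TSplitting {c ℓ : Level} (R : CommutativeRing c ℓ) where
  open CommutativeRing R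
  open Poly R
  open RingSolver commutativeSemiring

  -- In the ring identities below, a stands for q ^ k, and q ^ 2 unfolds to q * (q * 1#).
  split-recurrence-identity : ∀ x s q a v₀ v₁ v₂ →
    x * ((1# + q * (q * a)) * x * v₂ + q * a * (q * (q * 1#) * s) * v₁)
      + q * s * ((1# + q * a) * x * v₁ + a * (q * (q * 1#) * s) * v₀)
    ≈ (1# + q * (q * a)) * x * (x * v₂ + q * s * v₁)
      + q * (q * a) * s * (x * v₁ + q * s * v₀)
  split-recurrence-identity = solve 7 (λ x s q a v₀ v₁ v₂ →
    x :* ((con 1 :+ q :* (q :* a)) :* x :* v₂ :+ q :* a :* (q :* (q :* con 1) :* s) :* v₁)
      :+ q :* s :* ((con 1 :+ q :* a) :* x :* v₁ :+ a :* (q :* (q :* con 1) :* s) :* v₀)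
    := (con 1 :+ q :* (q :* a)) :* x :* (x :* v₂ :+ q :* s :* v₁)
      :+ q :* (q :* a) :* s :* (x :* v₁ :+ q :* s :* v₀)) refl

  split-identity₀ : ∀ x s q → x ≈ x * 1# + q * s * 0#
  split-identity₀ = solve 3 (λ x s q → x := x :* con 1 :+ q :* s :* con 0) refl

  split-identity₁ : ∀ x s q →
    (1# + q * 1#) * x * x + q * 1# * s * 1#
    ≈ x * ((1# + q * 1#) * x * 1# + 1# * (q * (q * 1#) * s) * 0#) + q * s * 1#
  split-identity₁ = solve 3 (λ x s q →
    (con 1 :+ q :* con 1) :* x :* x :+ q :* con 1 :* s :* con 1
    := x :* ((con 1 :+ q :* con 1) :* x :* con 1 :+ con 1 :* (q :* (q :* con 1) :* s) :* con 0)
       :+ q :* s :* con 1) refl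

  module _ (q x s : Carrier) where

    V : ℕ → Carrier
    V k = U₋ k x (q ^ 2 * s) q

    W : ℕ → Carrier
    W m = x * V (suc m) + q * s * V m

    W-recurrence : ∀ k →
      W (suc (suc k)) ≈ (1# + q ^ suc (suc k)) * x * W (suc k) + q ^ suc (suc k) * s * W k
    W-recurrence k = split-recurrence-identity x s q (q ^ k) (V k) (V (suc k)) (V (suc (suc k)))

    T≈W : ∀ m → T (suc m) x s q ≈ W m
    T≈W zero          = split-identity₀ x s q
    T≈W (suc zero)    = split-identity₁ x s q
    T≈W (suc (suc k)) = begin
      (1# + q ^ suc (suc k)) * x * T (suc (suc k)) x s q + q ^ suc (suc k) * s * T (suc k) x s q
        ≈⟨ +-cong (*-congˡ (T≈W (suc k))) (*-congˡ (T≈W k)) ⟩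
      (1# + q ^ suc (suc k)) * x * W (suc k) + q ^ suc (suc k) * s * W k
        ≈⟨ sym (W-recurrence k) ⟩
      W (suc (suc k)) ∎
      where open SetoidReasoning setoid

theorem2p6 : ∀ {c ℓ : Level} (R : CommutativeRing c ℓ) →
    let open CommutativeRing R
        open Poly R
    in ∀ (q : Carrier) → ¬ (q ≈ - 1#) →
       ∀ (x s : Carrier) (m : ℕ) →
       T (suc m) x s q ≈ x * U₋ (suc m) x (q ^ 2 * s) q + q * s * U₋ m x (q ^ 2 * s) q
theorem2p6 R q _ x s m = TSplitting.T≈W R q x s m
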